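{- Consider the cross-polytope $\mathrm{conv}\{\pm e_1,\dots,\pm e_4\}\subset\mathbb{R}^4$ with its 24 edges oriented as follows: $e_1\to e_2$, $e_2\to e_3$, $e_3\to e_1$, $-e_1\to-e_2$, $-e_2\to-e_3$, $-e_3\to-e_1$; $-e_2\to e_1$, $-e_3\to e_2$, $-e_1\to e_3$, $e_2\to-e_1$, $e_3\to-e_2$, $e_1\to-e_3$; $e_4\to e_i$ and $-e_4\to-e_i$ for $i=1,2,3$; $-e_i\to e_4$ and $e_i\to-e_4$ for $i=1,2,3$. Let $\mathcal{K}$ consist of all vertices and edges and of the 24 triangles of the cross-polytope other than the eight triangles $\pm\{e_1,e_2,e_3\}$, $\pm\{e_1,-e_4,-e_2\}$, $\pm\{e_2,-e_4,-e_3\}$, $\pm\{e_3,-e_4,-e_1\}$. Let $\tilde G$ be the group of symmetries of the cross-polytope (linear maps permuting $\{\pm e_i\}$) that map every oriented edge to an oriented edge (preserving the orientation). Let $G$ be the group of order 6 generated by $x\mapsto -x$ and $(x_1,x_2,x_3,x_4)\mapsto(x_2,x_3,x_1,x_4)$, and let $\rho(x_1,x_2,x_3,x_4)=(-x_2,x_1,-x_4,x_3)$. Then $\tilde G$ is a group of order 24 consisting of orientation-preserving maps (of determinant 1), generated by $G$ and $\rho$, and it acts transitively on the 24 edges, on the 24 triangles of $\mathcal{K}$, and on the eight triangles of the cross-polytope not in $\mathcal{K}$. -}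

module Defs where

open import Data.Bool using (Bool; true; false; not; if_then_else_)
open import Data.Fin using (Fin; zero; suc; punchIn)
open import Data.Fin.Properties using () renaming (_≟_ to _≟F_)
open import Data.Nat using (ℕ)
open import Data.Integer using (ℤ; +_; -_; _+_; _*_)
open import Data.Product using (_×_; _,_; proj₁; proj₂; ∃; ∃-syntax; Σ)
open import Data.Sum using (_⊎_)
open import Data.List using (List; []; _∷_)
open import Data.List.Membership.Propositional using (_∈_)
open import Relation.Binary.PropositionalEquality using (_≡_; _≢_)
open import Relation.Nullary using (¬_)
open import Relation.Nullary.Decidable using (⌊_⌋)
open import Function using (_∘_)

-- Vertices of the cross-polytope conv{±e₁,…,±e₄} ⊂ ℝ⁴.
-- (i , false) is +e_{i+1}, (i , true) is -e_{i+1}  (Fin 4 is 0-based).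

V : Set
V = Fin 4 × Bool

i1 i2 i3 i4 : Fin 4
i1 = zero
i2 = suc zero
i3 = suc (suc zero)
i4 = suc (suc (suc zero))

p : Fin 4 → V
p i = i , false

m : Fin 4 → V
m i = i , true

neg : V → V
neg (i , s) = i , not s

arcs : List (V × V)
arcs =
  (p i1 , p i2) ∷ (p i2 , p i3) ∷ (p i3 , p i1) ∷
  (m i1 , m i2) ∷ (m i2 , m i3) ∷ (m i3 , m i1) ∷
  (m i2 , p i1) ∷ (m i3 , p i2) ∷ (m i1 , p i3) ∷
  (p i2 , m i1) ∷ (p i3 , m i2) ∷ (p i1 , m i3) ∷
  (p i4 , p i1) ∷ (p i4 , p i2) ∷ (p i4 , p i3) ∷
  (m i4 , m i1) ∷ (m i4 , m i2) ∷ (m i4 , m i3) ∷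
  (m i1 , p i4) ∷ (m i2 , p i4) ∷ (m i3 , p i4) ∷
  (p i1 , m i4) ∷ (p i2 , m i4) ∷ (p i3 , m i4) ∷ []

Arc : V → V → Set
Arc u v = (u , v) ∈ arcs

-- Triangles (2-faces) of the cross-polytope: three pairwise distinct,
-- pairwise non-antipodal vertices. Triangles are compared as sets.

IsTriangle : V → V → V → Set
IsTriangle a b c =
  (a ≢ b) × (b ≢ c) × (a ≢ c) × (a ≢ neg b) × (b ≢ neg c) × (a ≢ neg c)

Tri : Set
Tri = V × V × V

_∈T_ : V → Tri → Set
x ∈T (a , b , c) = (x ≡ a) ⊎ (x ≡ b) ⊎ (x ≡ c)

SameSet : Tri → Tri → Set
SameSet t t' = ∀ x → (x ∈T t → x ∈T t') × (x ∈T t' → x ∈T t)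

excluded : List Tri
excluded =
  (p i1 , p i2 , p i3) ∷ (m i1 , m i2 , m i3) ∷
  (p i1 , m i4 , m i2) ∷ (m i1 , p i4 , p i2) ∷
  (p i2 , m i4 , m i3) ∷ (m i2 , p i4 , p i3) ∷
  (p i3 , m i4 , m i1) ∷ (m i3 , p i4 , p i1) ∷ []

IsExcluded : Tri → Set
IsExcluded t = Σ Tri (λ u → (u ∈ excluded) × SameSet t u)

InK : Tri → Set
InK (a , b , c) = IsTriangle a b c × ¬ IsExcluded (a , b , c)

NotInK : Tri → Set
NotInK (a , b , c) = IsTriangle a b c × IsExcluded (a , b , c)

-- Symmetries: linear maps permuting {±e_i}. Such a map is the same as a
-- bijection of V commuting with v ↦ -v (it is determined by, and
-- extends linearly from, its values on e₁,…,e₄).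

_≗_ : (V → V) → (V → V) → Set
f ≗ g = ∀ v → f v ≡ g v

IsSym : (V → V) → Set
IsSym f = (Σ (V → V) λ g → ((∀ v → f (g v) ≡ v) × (∀ v → g (f v) ≡ v)))
        × (∀ v → f (neg v) ≡ neg (f v))

InGt : (V → V) → Set
InGt f = IsSym f × (∀ u v → Arc u v → Arc (f u) (f v))

mapT : (V → V) → Tri → Tri
mapT f (a , b , c) = f a , f b , f c

sumFin : ∀ {n} → (Fin n → ℤ) → ℤ
sumFin {ℕ.zero} _ = + 0
sumFin {ℕ.suc n} h = h zero + sumFin (h ∘ suc)

altSign : ∀ {n} → Fin n → ℤ
altSign zero = + 1
altSign (suc j) = - altSign j

det : ∀ n → (Fin n → Fin n → ℤ) → ℤ
det ℕ.zero M = + 1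
det (ℕ.suc n) M =
  sumFin (λ j → altSign j * M zero j * det n (λ r k → M (suc r) (punchIn j k)))

-- entry (k , j) = k-th coordinate of the image of e_j
matrix : (V → V) → Fin 4 → Fin 4 → ℤ
matrix f k j =
  if ⌊ proj₁ (f (p j)) ≟F k ⌋
  then (if proj₂ (f (p j)) then - (+ 1) else + 1)
  else + 0

-- Generators: x ↦ -x,  (x₁,x₂,x₃,x₄) ↦ (x₂,x₃,x₁,x₄),
-- ρ(x₁,x₂,x₃,x₄) = (-x₂,x₁,-x₄,x₃), given by their action on ±e_i.

cycIdx : Fin 4 → Fin 4
cycIdx zero = i3
cycIdx (suc zero) = i1
cycIdx (suc (suc zero)) = i2
cycIdx (suc (suc (suc zero))) = i4

cyc : V → V
cyc (i , s) = cycIdx i , s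

ρ : V → V
ρ (zero , s) = i2 , s
ρ (suc zero , s) = i1 , not s
ρ (suc (suc zero) , s) = i4 , s
ρ (suc (suc (suc zero)) , s) = i3 , not s

data Gen : (V → V) → Set where
  gen-id  : Gen (λ v → v)
  gen-neg : Gen neg
  gen-cyc : Gen cyc
  gen-ρ   : Gen ρ
  gen-∘   : ∀ {f g} → Gen f → Gen g → Gen (f ∘ g)
  gen-inv : ∀ {f g} → Gen f → (∀ v → f (g v) ≡ v) → (∀ v → g (f v) ≡ v) → Gen g

{-# OPTIONS --safe #-}
module Submission where

-- G̃ acts freely on the 24 arcs. An element fixing the arc e₁ → e₂ fixes e₃, the only vertex closing a
-- directed triangle on that arc, and e₄, the only common source of e₁ and e₂; as it commutes with -id, it
-- is the identity. So 24 words in the generators carrying e₁ → e₂ onto the 24 arcs exhaust G̃, and the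
-- remaining claims become finite checks on them: their determinants, and the orbits of one triangle inside
-- and one outside 𝒦. Inverses stay in G̃ because every edge is oriented exactly one way.

open import Defs
open import Data.Bool using (true; false)
open import Data.Bool.Properties using () renaming (_≟_ to _≟B_)
open import Data.Fin using (Fin; zero; suc; punchIn)
open import Data.Fin.Properties using (all?; any?) renaming (_≟_ to _≟F_)
open import Data.Integer using (ℤ; +_; _+_; _*_)
open import Data.Integer.Properties using () renaming (_≟_ to _≟ℤ_)
open import Data.List using (List; []; _∷_; foldr; lookup)
open import Data.List.Membership.Propositional using (_∈_; find; lose)
import Data.List.Membership.DecPropositional as DecMembership
import Data.List.Relation.Unary.All as All
open import Data.List.Relation.Unary.Any as Any using (index)
open import Data.List.Relation.Unary.Any.Properties using (lookup-index)
open import Data.Nat using (ℕ)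
open import Data.Product using (_×_; _,_; proj₁; proj₂; Σ; ∃-syntax; swap; map₂)
open import Data.Product.Properties using (≡-dec; ,-injectiveˡ; ,-injectiveʳ)
open import Data.Sum using (_⊎_; inj₁; inj₂)
open import Data.Empty using (⊥-elim)
open import Data.Vec using (Vec) renaming (_∷_ to _∷ᵥ_; [] to []ᵥ; lookup to lookupᵥ)
open import Function using (_∘_; id)
open import Relation.Binary using (Setoid; IsEquivalence; DecidableEquality)
open import Relation.Binary.PropositionalEquality
  using (_≡_; refl; sym; trans; cong; cong₂; subst; subst₂; module ≡-Reasoning)
open import Relation.Nullary using (¬_; Dec)
open import Relation.Nullary.Decidable using (True; toWitness; from-yes; map′; ¬?; _×-dec_; _⊎-dec_; _→-dec_)

_≟V_ : DecidableEquality V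
_≟V_ = ≡-dec _≟F_ _≟B_

_≟E_ : DecidableEquality (V × V)
_≟E_ = ≡-dec _≟V_ _≟V_

open DecMembership _≟E_ using (_∈?_)

∀V? : {P : V → Set} → (∀ v → Dec (P v)) → Dec (∀ v → P v)
∀V? P? = map′ (λ h → λ { (i , false) → proj₁ (h i) ; (i , true) → proj₂ (h i) })
              (λ h i → h (i , false) , h (i , true))
              (all? λ i → P? (i , false) ×-dec P? (i , true))

Arc? : ∀ u v → Dec (Arc u v)
Arc? u v = (u , v) ∈? arcs

Arc-irrefl : ∀ v → ¬ Arc v v
Arc-irrefl = from-yes (∀V? λ v → ¬? (Arc? v v))

Arc-antipodal : ∀ v → ¬ Arc (neg v) v
Arc-antipodal = from-yes (∀V? λ v → ¬? (Arc? (neg v) v))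

Arc-asym : ∀ u v → Arc u v → ¬ Arc v u
Arc-asym = from-yes (∀V? λ u → ∀V? λ v → Arc? u v →-dec ¬? (Arc? v u))

Arc-connex : ∀ u v → u ≡ v ⊎ u ≡ neg v ⊎ Arc u v ⊎ Arc v u
Arc-connex = from-yes (∀V? λ u → ∀V? λ v → u ≟V v ⊎-dec u ≟V neg v ⊎-dec Arc? u v ⊎-dec Arc? v u)

cycle-unique : ∀ a b → Arc a b → ∀ c → Arc b c → Arc c a → ∀ c' → Arc b c' → Arc c' a → c ≡ c'
cycle-unique = from-yes (∀V? λ a → ∀V? λ b → Arc? a b →-dec ∀V? λ c → Arc? b c →-dec Arc? c a →-dec
                         ∀V? λ c' → Arc? b c' →-dec Arc? c' a →-dec c ≟V c')

commonSource-unique : ∀ a b → Arc a b → ∀ d → Arc d a → Arc d b → ∀ d' → Arc d' a → Arc d' b → d ≡ d'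
commonSource-unique = from-yes (∀V? λ a → ∀V? λ b → Arc? a b →-dec ∀V? λ d → Arc? d a →-dec Arc? d b →-dec
                                ∀V? λ d' → Arc? d' a →-dec Arc? d' b →-dec d ≟V d')

baseArc : Arc (p i1) (p i2)
baseArc = from-yes (Arc? (p i1) (p i2))

InGt-∘ : ∀ {f g} → InGt f → InGt g → InGt (f ∘ g)
InGt-∘ {f} {g} (((f⁻¹ , f∘f⁻¹ , f⁻¹∘f) , f-neg) , f-arc) (((g⁻¹ , g∘g⁻¹ , g⁻¹∘g) , g-neg) , g-arc) =
  ((g⁻¹ ∘ f⁻¹ , (λ v → trans (cong f (g∘g⁻¹ (f⁻¹ v))) (f∘f⁻¹ v))
               , (λ v → trans (cong g⁻¹ (f⁻¹∘f (g v))) (g⁻¹∘g v)))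
  , (λ v → trans (cong f (g-neg v)) (f-neg (g v))))
  , λ u v a → f-arc _ _ (g-arc u v a)

InGt-inverse : ∀ {f g} → InGt f → (∀ v → f (g v) ≡ v) → (∀ v → g (f v) ≡ v) → InGt g
InGt-inverse {f} {g} ((_ , f-neg) , f-arc) f∘g g∘f = ((f , g∘f , f∘g) , g-neg) , g-arc
  where
  open ≡-Reasoning

  g-neg : ∀ v → g (neg v) ≡ neg (g v)
  g-neg v = begin
    g (neg v)         ≡⟨ cong (g ∘ neg) (f∘g v) ⟨
    g (neg (f (g v))) ≡⟨ cong g (f-neg (g v)) ⟨
    g (f (neg (g v))) ≡⟨ g∘f (neg (g v)) ⟩
    neg (g v)         ∎

  g-arc : ∀ u v → Arc u v → Arc (g u) (g v)
  g-arc u v a = orient (Arc-connex (g u) (g v))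
    where
    f-cancel : ∀ {x y} → g x ≡ y → x ≡ f y
    f-cancel {x} refl = sym (f∘g x)

    orient : g u ≡ g v ⊎ g u ≡ neg (g v) ⊎ Arc (g u) (g v) ⊎ Arc (g v) (g u) → Arc (g u) (g v)
    orient (inj₁ gu≡gv) =
      ⊥-elim (Arc-irrefl v (subst (λ w → Arc w v) (trans (f-cancel gu≡gv) (f∘g v)) a))
    orient (inj₂ (inj₁ gu≡-gv)) =
      ⊥-elim (Arc-antipodal v (subst (λ w → Arc w v) u≡-v a))
      where
      u≡-v : u ≡ neg v
      u≡-v = trans (f-cancel gu≡-gv) (trans (f-neg (g v)) (cong neg (f∘g v)))
    orient (inj₂ (inj₂ (inj₁ a'))) = a'
    orient (inj₂ (inj₂ (inj₂ a'))) =
      ⊥-elim (Arc-asym u v a (subst₂ Arc (f∘g v) (f∘g u) (f-arc _ _ a')))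

inverseInGt : ∀ {f} → InGt f → Σ (V → V) λ g → InGt g × (∀ v → g (f v) ≡ v)
inverseInGt F@(((g , f∘g , g∘f) , _) , _) = g , InGt-inverse F f∘g g∘f , g∘f

InGt-byInverse : ∀ f g →
  True ((∀V? λ v → f (g v) ≟V v) ×-dec (∀V? λ v → g (f v) ≟V v)
        ×-dec (∀V? λ v → f (neg v) ≟V neg (f v))
        ×-dec All.all? (λ e → Arc? (f (proj₁ e)) (f (proj₂ e))) arcs) →
  InGt f
InGt-byInverse f g checks =
  let f∘g , g∘f , f-neg , f-arcs = toWitness checks in ((g , f∘g , g∘f) , f-neg) , λ u v → All.lookup f-arcs

Gen⇒InGt : ∀ {f} → Gen f → InGt f
Gen⇒InGt gen-id = InGt-byInverse id id _
Gen⇒InGt gen-neg = InGt-byInverse neg neg _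
Gen⇒InGt gen-cyc = InGt-byInverse cyc (cyc ∘ cyc) _
Gen⇒InGt gen-ρ = InGt-byInverse ρ (ρ ∘ neg) _    -- ρ² = -id
Gen⇒InGt (gen-∘ f g) = InGt-∘ (Gen⇒InGt f) (Gen⇒InGt g)
Gen⇒InGt (gen-inv f f∘g g∘f) = InGt-inverse (Gen⇒InGt f) f∘g g∘f

≗-fromBasis : ∀ {f g} → (∀ v → f (neg v) ≡ neg (f v)) → (∀ v → g (neg v) ≡ neg (g v)) →
              (∀ i → f (p i) ≡ g (p i)) → f ≗ g
≗-fromBasis f-neg g-neg eq (i , false) = eq i
≗-fromBasis {f} {g} f-neg g-neg eq (i , true) = begin
  f (neg (p i)) ≡⟨ f-neg (p i) ⟩
  neg (f (p i)) ≡⟨ cong neg (eq i) ⟩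
  neg (g (p i)) ≡⟨ g-neg (p i) ⟨
  g (neg (p i)) ∎
  where open ≡-Reasoning

InGt-determinedByBaseArc : ∀ {f g} → InGt f → InGt g →
                           f (p i1) ≡ g (p i1) → f (p i2) ≡ g (p i2) → f ≗ g
InGt-determinedByBaseArc {f} {g} ((_ , f-neg) , f-arc) ((_ , g-neg) , g-arc) e₁ e₂ =
  ≗-fromBasis f-neg g-neg agree
  where
  F : ∀ {u v} → Arc u v → Arc (f u) (f v)
  F = f-arc _ _
  G : ∀ {u v} → Arc u v → Arc (g u) (g v)
  G = g-arc _ _
  a₂₃ : Arc (p i2) (p i3)
  a₂₃ = from-yes (Arc? (p i2) (p i3))
  a₃₁ : Arc (p i3) (p i1)
  a₃₁ = from-yes (Arc? (p i3) (p i1))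
  a₄₁ : Arc (p i4) (p i1)
  a₄₁ = from-yes (Arc? (p i4) (p i1))
  a₄₂ : Arc (p i4) (p i2)
  a₄₂ = from-yes (Arc? (p i4) (p i2))

  agree : ∀ i → f (p i) ≡ g (p i)
  agree zero = e₁
  agree (suc zero) = e₂
  agree (suc (suc zero)) =
    cycle-unique _ _ (F baseArc) _ (F a₂₃) (F a₃₁)
                 _ (subst₂ Arc (sym e₂) refl (G a₂₃)) (subst₂ Arc refl (sym e₁) (G a₃₁))
  agree (suc (suc (suc zero))) =
    commonSource-unique _ _ (F baseArc) _ (F a₄₁) (F a₄₂)
                        _ (subst₂ Arc refl (sym e₁) (G a₄₁)) (subst₂ Arc refl (sym e₂) (G a₄₂))

data Letter : Set where
  `neg `cyc `ρ : Letter

Word : Set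
Word = List Letter

⟦_⟧ : Letter → V → V
⟦ `neg ⟧ = neg
⟦ `cyc ⟧ = cyc
⟦ `ρ ⟧ = ρ

evalWord : Word → V → V
evalWord = foldr (λ a f → ⟦ a ⟧ ∘ f) id

Gen-evalWord : ∀ w → Gen (evalWord w)
Gen-evalWord [] = gen-id
Gen-evalWord (`neg ∷ w) = gen-∘ gen-neg (Gen-evalWord w)
Gen-evalWord (`cyc ∷ w) = gen-∘ gen-cyc (Gen-evalWord w)
Gen-evalWord (`ρ ∷ w) = gen-∘ gen-ρ (Gen-evalWord w)

elementWords : Vec Word 24
elementWords =
  [] ∷ᵥ (`cyc ∷ `cyc ∷ []) ∷ᵥ (`cyc ∷ []) ∷ᵥ
  (`neg ∷ []) ∷ᵥ (`neg ∷ `cyc ∷ `cyc ∷ []) ∷ᵥ (`neg ∷ `cyc ∷ []) ∷ᵥ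
  (`neg ∷ `ρ ∷ []) ∷ᵥ (`neg ∷ `cyc ∷ `cyc ∷ `ρ ∷ []) ∷ᵥ (`neg ∷ `cyc ∷ `ρ ∷ []) ∷ᵥ
  (`ρ ∷ []) ∷ᵥ (`cyc ∷ `cyc ∷ `ρ ∷ []) ∷ᵥ (`cyc ∷ `ρ ∷ []) ∷ᵥ
  (`cyc ∷ `ρ ∷ `cyc ∷ []) ∷ᵥ (`ρ ∷ `cyc ∷ []) ∷ᵥ (`cyc ∷ `cyc ∷ `ρ ∷ `cyc ∷ []) ∷ᵥ
  (`neg ∷ `cyc ∷ `ρ ∷ `cyc ∷ []) ∷ᵥ (`neg ∷ `ρ ∷ `cyc ∷ []) ∷ᵥ (`neg ∷ `cyc ∷ `cyc ∷ `ρ ∷ `cyc ∷ []) ∷ᵥ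
  (`ρ ∷ `cyc ∷ `cyc ∷ []) ∷ᵥ (`neg ∷ `ρ ∷ `cyc ∷ `ρ ∷ []) ∷ᵥ (`cyc ∷ `ρ ∷ `cyc ∷ `cyc ∷ []) ∷ᵥ
  (`neg ∷ `ρ ∷ `cyc ∷ `cyc ∷ []) ∷ᵥ (`ρ ∷ `cyc ∷ `ρ ∷ []) ∷ᵥ (`neg ∷ `cyc ∷ `ρ ∷ `cyc ∷ `cyc ∷ []) ∷ᵥ []ᵥ

element : Fin 24 → V → V
element k = evalWord (lookupᵥ elementWords k)

element-Gen : ∀ k → Gen (element k)
element-Gen k = Gen-evalWord (lookupᵥ elementWords k)

element-InGt : ∀ k → InGt (element k)
element-InGt = Gen⇒InGt ∘ element-Gen

element-baseArc : ∀ k → (element k (p i1) , element k (p i2)) ≡ lookup arcs k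
element-baseArc = from-yes (all? λ k → (element k (p i1) , element k (p i2)) ≟E lookup arcs k)

lookup-arcs-injective : ∀ k l → lookup arcs k ≡ lookup arcs l → k ≡ l
lookup-arcs-injective = from-yes (all? λ k → all? λ l → lookup arcs k ≟E lookup arcs l →-dec k ≟F l)

element-injective : ∀ k l → element k ≗ element l → k ≡ l
element-injective k l eq = lookup-arcs-injective k l (begin
  lookup arcs k                              ≡⟨ element-baseArc k ⟨
  (element k (p i1) , element k (p i2))      ≡⟨ cong₂ _,_ (eq (p i1)) (eq (p i2)) ⟩
  (element l (p i1) , element l (p i2))      ≡⟨ element-baseArc l ⟩
  lookup arcs l                              ∎)
  where open ≡-Reasoning

arc-orbit : ∀ {u v} (a : Arc u v) → element (index a) (p i1) ≡ u × element (index a) (p i2) ≡ v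
arc-orbit {u} {v} a = ,-injectiveˡ base , ,-injectiveʳ base
  where
  base : (element (index a) (p i1) , element (index a) (p i2)) ≡ (u , v)
  base = trans (element-baseArc (index a)) (sym (lookup-index a))

InGt⇒element : ∀ {f} → InGt f → ∃[ k ] element k ≗ f
InGt⇒element {f} F@(_ , f-arc) = index a , InGt-determinedByBaseArc (element-InGt (index a)) F e₁ e₂
  where
  a : Arc (f (p i1)) (f (p i2))
  a = f-arc _ _ baseArc
  e₁ : element (index a) (p i1) ≡ f (p i1)
  e₁ = proj₁ (arc-orbit a)
  e₂ : element (index a) (p i2) ≡ f (p i2)
  e₂ = proj₂ (arc-orbit a)

InGt⇒Gen : ∀ {f} → InGt f → Σ (V → V) λ g → Gen g × g ≗ f
InGt⇒Gen F = let k , e = InGt⇒element F in element k , element-Gen k , e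

sumFin-cong : ∀ {n} {h h' : Fin n → ℤ} → (∀ j → h j ≡ h' j) → sumFin h ≡ sumFin h'
sumFin-cong {ℕ.zero} eq = refl
sumFin-cong {ℕ.suc n} eq = cong₂ _+_ (eq zero) (sumFin-cong (eq ∘ suc))

det-cong : ∀ n {M M' : Fin n → Fin n → ℤ} → (∀ i j → M i j ≡ M' i j) → det n M ≡ det n M'
det-cong ℕ.zero eq = refl
det-cong (ℕ.suc n) eq = sumFin-cong λ j →
  cong₂ _*_ (cong (altSign j *_) (eq zero j)) (det-cong n λ r k → eq (suc r) (punchIn j k))

matrix-cong : ∀ {f g} → f ≗ g → ∀ i j → matrix f i j ≡ matrix g i j
matrix-cong eq i j rewrite eq (p j) = refl

element-det : ∀ k → det 4 (matrix (element k)) ≡ + 1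
element-det = from-yes (all? λ k → det 4 (matrix (element k)) ≟ℤ + 1)

InGt-det : ∀ f → InGt f → det 4 (matrix f) ≡ + 1
InGt-det f F = let k , e = InGt⇒element F in
  trans (det-cong 4 (matrix-cong λ v → sym (e v))) (element-det k)

InGt-between : ∀ {f f'} → InGt f → InGt f' → Σ (V → V) λ h → InGt h × (∀ x → h (f x) ≡ f' x)
InGt-between {f' = f'} F F' = let g , G , g∘f = inverseInGt F in f' ∘ g , InGt-∘ F' G , cong f' ∘ g∘f

arc-transitive : ∀ u v u' v' → Arc u v → Arc u' v' → Σ (V → V) λ f → InGt f × f u ≡ u' × f v ≡ v'
arc-transitive u v u' v' a a' =
  let h , H , h-carries = InGt-between (element-InGt (index a)) (element-InGt (index a'))
      e₁  , e₂  = arc-orbit a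
      e₁' , e₂' = arc-orbit a'
  in h , H , trans (cong h (sym e₁)) (trans (h-carries _) e₁')
           , trans (cong h (sym e₂)) (trans (h-carries _) e₂')

SameSet-isEquivalence : IsEquivalence SameSet
SameSet-isEquivalence = record
  { refl  = λ _ → id , id
  ; sym   = λ t≈t' x → swap (t≈t' x)
  ; trans = λ t≈t' t'≈t'' x → proj₁ (t'≈t'' x) ∘ proj₁ (t≈t' x) , proj₂ (t≈t' x) ∘ proj₂ (t'≈t'' x)
  }

triangleSetoid : Setoid _ _
triangleSetoid = record { isEquivalence = SameSet-isEquivalence }

open Setoid triangleSetoid using () renaming (sym to ≈-sym; trans to ≈-trans)

∈T-mapT : ∀ f {x} t → x ∈T t → f x ∈T mapT f t
∈T-mapT f _ (inj₁ refl) = inj₁ refl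
∈T-mapT f _ (inj₂ (inj₁ refl)) = inj₂ (inj₁ refl)
∈T-mapT f _ (inj₂ (inj₂ refl)) = inj₂ (inj₂ refl)

mapT-⊆ : ∀ f {t t'} → (∀ x → x ∈T t → x ∈T t') → ∀ x → x ∈T mapT f t → x ∈T mapT f t'
mapT-⊆ f {a , _ , _} {t'} t⊆t' _ (inj₁ refl) = ∈T-mapT f t' (t⊆t' a (inj₁ refl))
mapT-⊆ f {_ , b , _} {t'} t⊆t' _ (inj₂ (inj₁ refl)) = ∈T-mapT f t' (t⊆t' b (inj₂ (inj₁ refl)))
mapT-⊆ f {_ , _ , c} {t'} t⊆t' _ (inj₂ (inj₂ refl)) = ∈T-mapT f t' (t⊆t' c (inj₂ (inj₂ refl)))

mapT-cong : ∀ f {t t'} → SameSet t t' → SameSet (mapT f t) (mapT f t')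
mapT-cong f t≈t' x = mapT-⊆ f (proj₁ ∘ t≈t') x , mapT-⊆ f (proj₂ ∘ t≈t') x

mapT-≗ : ∀ {f g} → f ≗ g → ∀ t → mapT f t ≡ mapT g t
mapT-≗ eq (a , b , c) = cong₂ _,_ (eq a) (cong₂ _,_ (eq b) (eq c))

triangle-transitive : (P : Tri → Set) (t₀ : Tri) →
                      (∀ {t} → P t → ∃[ k ] SameSet (mapT (element k) t₀) t) →
                      ∀ t t' → P t → P t' → Σ (V → V) λ f → InGt f × SameSet (mapT f t) t'
triangle-transitive P t₀ orbit t t' Pt Pt' =
  let k  , k≈  = orbit Pt
      k' , k'≈ = orbit Pt'
      h , H , h-carries = InGt-between (element-InGt k) (element-InGt k')
  in h , H , (begin
       mapT h t                      ≈⟨ mapT-cong h (≈-sym k≈) ⟩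
       mapT h (mapT (element k) t₀)  ≡⟨ mapT-≗ h-carries t₀ ⟩
       mapT (element k') t₀          ≈⟨ k'≈ ⟩
       t'                            ∎)
  where open import Relation.Binary.Reasoning.Setoid triangleSetoid

_∈T?_ : ∀ x t → Dec (x ∈T t)
x ∈T? (a , b , c) = x ≟V a ⊎-dec x ≟V b ⊎-dec x ≟V c

SameSet? : ∀ t t' → Dec (SameSet t t')
SameSet? t t' = ∀V? λ x → (x ∈T? t →-dec x ∈T? t') ×-dec (x ∈T? t' →-dec x ∈T? t)

IsExcluded? : ∀ t → Dec (IsExcluded t)
IsExcluded? t = map′ find (λ (_ , u∈ , t≈u) → lose u∈ t≈u) (Any.any? (SameSet? t) excluded)

IsTriangle? : ∀ a b c → Dec (IsTriangle a b c)
IsTriangle? a b c = ¬? (a ≟V b) ×-dec ¬? (b ≟V c) ×-dec ¬? (a ≟V c)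
                    ×-dec ¬? (a ≟V neg b) ×-dec ¬? (b ≟V neg c) ×-dec ¬? (a ≟V neg c)

InK? : ∀ t → Dec (InK t)
InK? (a , b , c) = IsTriangle? a b c ×-dec ¬? (IsExcluded? (a , b , c))

transitiveTriangle : Tri
transitiveTriangle = p i1 , p i2 , m i4

cyclicTriangle : Tri
cyclicTriangle = p i1 , p i2 , p i3

InK-orbit : ∀ {t} → InK t → ∃[ k ] SameSet (mapT (element k) transitiveTriangle) t
InK-orbit {a , b , c} = from-yes (∀V? λ a → ∀V? λ b → ∀V? λ c → InK? (a , b , c) →-dec
                                   any? λ k → SameSet? (mapT (element k) transitiveTriangle) (a , b , c)) a b c

excluded-orbit : ∀ {u} → u ∈ excluded → ∃[ k ] SameSet (mapT (element k) cyclicTriangle) u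
excluded-orbit = All.lookup (from-yes
  (All.all? (λ u → any? λ k → SameSet? (mapT (element k) cyclicTriangle) u) excluded))

NotInK-orbit : ∀ {t} → NotInK t → ∃[ k ] SameSet (mapT (element k) cyclicTriangle) t
NotInK-orbit (_ , _ , u∈ , t≈u) = map₂ (λ k≈u → ≈-trans k≈u (≈-sym t≈u)) (excluded-orbit u∈)

proposition3p2 :
    -- |G̃| = 24
    (Σ (Fin 24 → V → V) λ enum → ((∀ (k : Fin 24) → InGt (enum k))
              × (∀ (k l : Fin 24) → enum k ≗ enum l → k ≡ l)
              × (∀ (f : V → V) → InGt f → ∃[ k ] (enum k ≗ f))))
    -- every element of G̃ has determinant 1
    × (∀ (f : V → V) → InGt f → det 4 (matrix f) ≡ + 1)
    -- G̃ is generated by G and ρ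
    × (∀ (f : V → V) → Gen f → InGt f)
    × (∀ (f : V → V) → InGt f → Σ (V → V) λ g → (Gen g × g ≗ f))
    -- transitive on the 24 (oriented) edges
    × (∀ (u v u' v' : V) → Arc u v → Arc u' v' →
         Σ (V → V) λ f → (InGt f × f u ≡ u' × f v ≡ v'))
    -- transitive on the 24 triangles of 𝒦
    × (∀ (t t' : Tri) → InK t → InK t' → Σ (V → V) λ f → (InGt f × SameSet (mapT f t) t'))
    -- transitive on the 8 triangles not in 𝒦
    × (∀ (t t' : Tri) → NotInK t → NotInK t' → Σ (V → V) λ f → (InGt f × SameSet (mapT f t) t'))
proposition3p2 =
    (element , element-InGt , element-injective , λ _ → InGt⇒element)
  , InGt-det
  , (λ _ → Gen⇒InGt)
  , (λ _ → InGt⇒Gen)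
  , arc-transitive
  , triangle-transitive InK transitiveTriangle InK-orbit
  , triangle-transitive NotInK cyclicTriangle NotInK-orbit
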